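{- Let $G$ be a graph with vertices $v_1,\dots,v_n$ and let $r$ be a positive integer. Let $G'_r$ be obtained from $G$ by adding a clique on $n$ new vertices $u_1,\dots,u_n$ and, for every $1\le i\le n$, making $u_i$ adjacent to every vertex of $B_G(v_i,r)=\{x\in V(G): dist_G(v_i,x)\le r\}$. Then $tb(G)\le r$ if and only if $tb(G'_r)\le 1$.
   Context: Graphs are finite, simple, connected and unweighted. A tree decomposition of $G=(V,E)$ is a tree $T$ with bags $X_t\subseteq V$ such that every vertex lies in a bag, every edge has both ends in a common bag, and for each vertex the bags containing it induce a subtree. The breadth of a tree decomposition is $\max_t\min_{v\in V}\max_{w\in X_t}dist_G(v,w)$, and the tree-breadth $tb(G)$ is the minimum breadth of a tree decomposition of $G$. -}

module Defs where

open import Level using (0ℓ)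
open import Data.Nat using (ℕ; zero; suc; _+_; _≤_; _<_)
open import Data.Fin using (Fin; zero; suc; inject₁; fromℕ; splitAt)
open import Data.Fin.Subset using (Subset; _∈_)
open import Data.Sum using (_⊎_; inj₁; inj₂)
open import Data.Product using (Σ; ∃; _×_; _,_)
open import Data.Unit using (⊤)
open import Relation.Nullary using (¬_)
open import Relation.Binary.PropositionalEquality using (_≡_; _≢_; refl; sym)
open import Function.Definitions using (Injective)

record Graph (n : ℕ) : Set₁ where
  field
    Adj    : Fin n → Fin n → Set
    symm   : ∀ {x y} → Adj x y → Adj y x
    irrefl : ∀ {x} → ¬ Adj x x
open Graph public

data Walk {n : ℕ} (G : Graph n) (P : Fin n → Set) : Fin n → Fin n → ℕ → Set where
  here : ∀ {x} → P x → Walk G P x x zero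
  step : ∀ {x y z k} → P x → Adj G x y → Walk G P y z k → Walk G P x z (suc k)

Any : ∀ {n} → Fin n → Set
Any _ = ⊤

Connected : ∀ {n} → Graph n → Set
Connected G = ∀ u v → ∃ λ k → Walk G Any u v k

IsDist : ∀ {n} → Graph n → Fin n → Fin n → ℕ → Set
IsDist G u v d = Walk G Any u v d × (∀ j → Walk G Any u v j → d ≤ j)

DistLe : ∀ {n} → Graph n → Fin n → Fin n → ℕ → Set
DistLe G u v k = ∃ λ d → IsDist G u v d × d ≤ k

HasCycle : ∀ {m} → Graph m → Set
HasCycle {m} T = ∃ λ k → Σ (Fin (suc (suc (suc k))) → Fin m) λ c →
    Injective _≡_ _≡_ c
  × (∀ (i : Fin (suc (suc k))) → Adj T (c (inject₁ i)) (c (suc i)))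
  × Adj T (c (fromℕ (suc (suc k)))) (c zero)

record IsTree {m : ℕ} (T : Graph m) : Set where
  field
    nonempty  : 0 < m
    connected : Connected T
    acyclic   : ¬ HasCycle T

record TreeDecomposition {n : ℕ} (G : Graph n) : Set₁ where
  field
    m       : ℕ
    T       : Graph m
    isTree  : IsTree T
    bag     : Fin m → Subset n
    cover   : ∀ v → ∃ λ t → v ∈ bag t
    edges   : ∀ {x y} → Adj G x y → ∃ λ t → (x ∈ bag t) × (y ∈ bag t)
    subtree : ∀ v t₁ t₂ → v ∈ bag t₁ → v ∈ bag t₂ →
              ∃ λ k → Walk T (λ t → v ∈ bag t) t₁ t₂ k
open TreeDecomposition public

BreadthLe : ∀ {n} {G : Graph n} → TreeDecomposition G → ℕ → Set
BreadthLe {n} {G} D ρ = ∀ t → ∃ λ v → ∀ w → w ∈ bag D t → DistLe G v w ρ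

TreeBreadthLe : ∀ {n} → Graph n → ℕ → Set₁
TreeBreadthLe G ρ = ∃ λ (D : TreeDecomposition G) → BreadthLe D ρ

-- The graph G'_r on Fin (n + n): v_i = i ↑ˡ n (inj₁ i), u_i = n ↑ʳ i (inj₂ i).
extAdj : ∀ {n} → Graph n → ℕ → Fin n ⊎ Fin n → Fin n ⊎ Fin n → Set
extAdj G r (inj₁ a) (inj₁ b) = Adj G a b
extAdj G r (inj₁ a) (inj₂ i) = DistLe G i a r
extAdj G r (inj₂ i) (inj₁ a) = DistLe G i a r
extAdj G r (inj₂ i) (inj₂ j) = i ≢ j

extSym : ∀ {n} (G : Graph n) r a b → extAdj G r a b → extAdj G r b a
extSym G r (inj₁ a) (inj₁ b) p = symm G p
extSym G r (inj₁ a) (inj₂ i) p = p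
extSym G r (inj₂ i) (inj₁ a) p = p
extSym G r (inj₂ i) (inj₂ j) p = λ e → p (sym e)

extIrrefl : ∀ {n} (G : Graph n) r a → ¬ extAdj G r a a
extIrrefl G r (inj₁ a) p = irrefl G p
extIrrefl G r (inj₂ i) p = p refl

Ext : ∀ {n} → Graph n → ℕ → Graph (n + n)
Ext {n} G r = record
  { Adj    = λ x y → extAdj G r (splitAt n x) (splitAt n y)
  ; symm   = λ {x} {y} → extSym G r (splitAt n x) (splitAt n y)
  ; irrefl = λ {x} → extIrrefl G r (splitAt n x)
  }

-- A decomposition of G of breadth r gives one of G'_r of breadth 1 by adding the whole
-- clique u₁ … uₙ to every bag: a bag of G within distance r of vᵢ lies in the closed
-- neighbourhood of uᵢ.  Conversely, restricting a decomposition of G'_r of breadth 1 to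
-- v₁ … vₙ gives one of G of breadth r: a bag lying in the closed neighbourhood of vᵢ or of
-- uᵢ lies within distance r of vᵢ in G, as r ≥ 1 and N[uᵢ] ∩ V(G) = B_G(vᵢ, r).
module Submission where

open import Defs
open import Data.Nat using (ℕ; zero; suc; _≤_; _<_; _+_; z≤n; s≤s)
open import Data.Fin using (Fin; zero; suc; splitAt; _↑ˡ_; _↑ʳ_; fromℕ<)
open import Data.Fin.Properties using (_≟_; ↑ˡ-injective; splitAt-↑ˡ; splitAt-↑ʳ; splitAt⁻¹-↑ˡ; splitAt⁻¹-↑ʳ)
open import Data.Fin.Subset using (Subset; _∈_; ⊤)
open import Data.Fin.Subset.Properties using (∈⊤)
open import Data.Vec using ([]; _∷_; _++_; here; there; lookup; tabulate)
open import Data.Vec.Properties using (lookup∘tabulate; []=⇒lookup; lookup⇒[]=)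
open import Data.Sum using (_⊎_; inj₁; inj₂)
open import Data.Product using (∃; _×_; _,_; proj₂)
open import Data.Unit using (tt)
open import Data.Empty using (⊥-elim)
open import Function.Base using (id)
open import Function.Bundles using (_⇔_; mk⇔)
open import Relation.Nullary using (yes; no)
open import Relation.Binary.PropositionalEquality using (_≡_; _≢_; refl; sym; trans; cong; cong₂; subst)

data SplitAtView (m n : ℕ) : Fin (m + n) → Set where
  left  : ∀ a → SplitAtView m n (a ↑ˡ n)
  right : ∀ i → SplitAtView m n (m ↑ʳ i)

splitAtView : ∀ m n x → SplitAtView m n x
splitAtView m n x with splitAt m {n} x in eq
... | inj₁ a = subst (SplitAtView m n) (splitAt⁻¹-↑ˡ eq) (left a)
... | inj₂ i = subst (SplitAtView m n) (splitAt⁻¹-↑ʳ eq) (right i)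

↑ʳ≢↑ˡ : ∀ m {n} (i : Fin n) (a : Fin m) → m ↑ʳ i ≢ a ↑ˡ n
↑ʳ≢↑ˡ m {n} i a eq
  with trans (sym (splitAt-↑ʳ m n i)) (trans (cong (splitAt m) eq) (splitAt-↑ˡ m a n))
... | ()

module _ {m : ℕ} where

  preimage : ∀ {n} → (Fin m → Fin n) → Subset n → Subset m
  preimage f p = tabulate (λ x → lookup p (f x))

  ∈-preimage⁺ : ∀ {n} {f : Fin m → Fin n} {p x} → f x ∈ p → x ∈ preimage f p
  ∈-preimage⁺ {x = x} fx∈p =
    lookup⇒[]= x _ (trans (lookup∘tabulate _ x) ([]=⇒lookup fx∈p))

  ∈-preimage⁻ : ∀ {n} {f : Fin m → Fin n} {p x} → x ∈ preimage f p → f x ∈ p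
  ∈-preimage⁻ {f = f} {p} {x} x∈ =
    lookup⇒[]= (f x) p (trans (sym (lookup∘tabulate _ x)) ([]=⇒lookup x∈))

∈-++⁺ˡ : ∀ {m n} {p : Subset m} {q : Subset n} {x} → x ∈ p → x ↑ˡ n ∈ p ++ q
∈-++⁺ˡ here       = here
∈-++⁺ˡ (there x∈) = there (∈-++⁺ˡ x∈)

∈-++⁻ˡ : ∀ {m n} {p : Subset m} {q : Subset n} {x} → x ↑ˡ n ∈ p ++ q → x ∈ p
∈-++⁻ˡ {p = _ ∷ _} {x = zero}  here       = here
∈-++⁻ˡ {p = _ ∷ _} {x = suc _} (there x∈) = there (∈-++⁻ˡ x∈)

∈-++⁺ʳ : ∀ {m n} (p : Subset m) {q : Subset n} {i} → i ∈ q → m ↑ʳ i ∈ p ++ q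
∈-++⁺ʳ []      i∈ = i∈
∈-++⁺ʳ (_ ∷ p) i∈ = there (∈-++⁺ʳ p i∈)

module _ {n : ℕ} {H : Graph n} where

  Walk-map : ∀ {P Q : Fin n → Set} → (∀ {x} → P x → Q x) →
             ∀ {x y k} → Walk H P x y k → Walk H Q x y k
  Walk-map f (here px)       = here (f px)
  Walk-map f (step px xy xs) = step (f px) xy (Walk-map f xs)

  DistLe-refl : ∀ x k → DistLe H x x k
  DistLe-refl x k = 0 , (here tt , λ _ _ → z≤n) , z≤n

  Adj⇒DistLe : ∀ {x y k} → Adj H x y → 1 ≤ k → DistLe H x y k
  Adj⇒DistLe {x} {y} xy 1≤k = 1 , (step tt xy (here tt) , shortest) , 1≤k
    where
    shortest : ∀ j → Walk H Any x y j → 1 ≤ j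
    shortest zero    (here _) = ⊥-elim (irrefl H xy)
    shortest (suc _) _        = s≤s z≤n

  DistLe-1⇒≡⊎Adj : ∀ {x y} → DistLe H x y 1 → x ≡ y ⊎ Adj H x y
  DistLe-1⇒≡⊎Adj (zero         , (here _             , _) , _) = inj₁ refl
  DistLe-1⇒≡⊎Adj (suc zero     , (step _ xy (here _) , _) , _) = inj₂ xy
  DistLe-1⇒≡⊎Adj (suc (suc _)  , _                        , s≤s ())

WithinDist : ∀ {n} → Graph n → ℕ → Fin n → Subset n → Set
WithinDist H ρ x X = ∀ w → w ∈ X → DistLe H x w ρ

comap : ∀ {n n′} {G : Graph n} {H : Graph n′} (f : Fin n → Fin n′) →
        (∀ {a b} → Adj G a b → Adj H (f a) (f b)) →
        TreeDecomposition H → TreeDecomposition G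
comap f f-hom D = record
  { m       = m D
  ; T       = T D
  ; isTree  = isTree D
  ; bag     = λ t → preimage f (bag D t)
  ; cover   = λ a → let (t , fa∈) = cover D (f a) in t , ∈-preimage⁺ fa∈
  ; edges   = λ ab → let (t , fa∈ , fb∈) = edges D (f-hom ab)
                     in t , ∈-preimage⁺ fa∈ , ∈-preimage⁺ fb∈
  ; subtree = λ a t₁ t₂ a∈₁ a∈₂ →
      let (k , path) = subtree D (f a) t₁ t₂ (∈-preimage⁻ a∈₁) (∈-preimage⁻ a∈₂)
      in k , Walk-map ∈-preimage⁺ path
  }

-- The last k vertices may be adjacent to anything, so they are put in every bag.
addApices : ∀ {n k} {G : Graph n} {H : Graph (n + k)} →
            (∀ {a b} → Adj H (a ↑ˡ k) (b ↑ˡ k) → Adj G a b) →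
            TreeDecomposition G → TreeDecomposition H
addApices {n} {k} {G} {H} restricts D = record
  { m       = m D
  ; T       = T D
  ; isTree  = isTree D
  ; bag     = bag′
  ; cover   = cover′
  ; edges   = λ {x} {y} → edges′ (splitAtView n k x) (splitAtView n k y)
  ; subtree = λ x → subtree′ (splitAtView n k x)
  }
  where
  bag′ : Fin (m D) → Subset (n + k)
  bag′ t = bag D t ++ ⊤

  apex∈ : ∀ t i → n ↑ʳ i ∈ bag′ t
  apex∈ t i = ∈-++⁺ʳ (bag D t) ∈⊤

  root : Fin (m D)
  root = fromℕ< (IsTree.nonempty (isTree D))

  cover′ : ∀ x → ∃ λ t → x ∈ bag′ t
  cover′ x with splitAtView n k x
  ... | left a  = let (t , a∈) = cover D a in t , ∈-++⁺ˡ a∈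
  ... | right i = root , apex∈ root i

  edges′ : ∀ {x y} → SplitAtView n k x → SplitAtView n k y → Adj H x y →
           ∃ λ t → x ∈ bag′ t × y ∈ bag′ t
  edges′ (left a)  (left b)  ab = let (t , a∈ , b∈) = edges D (restricts ab)
                                  in t , ∈-++⁺ˡ a∈ , ∈-++⁺ˡ b∈
  edges′ (left a)  (right j) _  = let (t , a∈) = cover D a in t , ∈-++⁺ˡ a∈ , apex∈ t j
  edges′ (right i) (left b)  _  = let (t , b∈) = cover D b in t , apex∈ t i , ∈-++⁺ˡ b∈
  edges′ (right i) (right j) _  = root , apex∈ root i , apex∈ root j

  subtree′ : ∀ {x} → SplitAtView n k x → ∀ t₁ t₂ → x ∈ bag′ t₁ → x ∈ bag′ t₂ →
             ∃ λ l → Walk (T D) (λ t → x ∈ bag′ t) t₁ t₂ l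
  subtree′ (left a) t₁ t₂ a∈₁ a∈₂ =
    let (l , path) = subtree D a t₁ t₂ (∈-++⁻ˡ a∈₁) (∈-++⁻ˡ a∈₂) in l , Walk-map ∈-++⁺ˡ path
  subtree′ (right i) t₁ t₂ _ _ =
    let (l , path) = IsTree.connected (isTree D) t₁ t₂ in l , Walk-map (λ {t} _ → apex∈ t i) path

module _ {n} (G : Graph n) (r : ℕ) where

  private
    G′ : Graph (n + n)
    G′ = Ext G r

  Adj-Ext-original : ∀ a b → Adj G′ (a ↑ˡ n) (b ↑ˡ n) ≡ Adj G a b
  Adj-Ext-original a b = cong₂ (extAdj G r) (splitAt-↑ˡ n a n) (splitAt-↑ˡ n b n)

  Adj-Ext-ball : ∀ i a → Adj G′ (n ↑ʳ i) (a ↑ˡ n) ≡ DistLe G i a r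
  Adj-Ext-ball i a = cong₂ (extAdj G r) (splitAt-↑ʳ n n i) (splitAt-↑ˡ n a n)

  Adj-Ext-clique : ∀ i j → Adj G′ (n ↑ʳ i) (n ↑ʳ j) ≡ (i ≢ j)
  Adj-Ext-clique i j = cong₂ (extAdj G r) (splitAt-↑ʳ n n i) (splitAt-↑ʳ n n j)

  apex-WithinDist : ∀ {c X} → WithinDist G r c X → WithinDist G′ 1 (n ↑ʳ c) (X ++ ⊤)
  apex-WithinDist {c} ball w w∈ with splitAtView n n w
  ... | left a = Adj⇒DistLe (subst id (sym (Adj-Ext-ball c a)) (ball a (∈-++⁻ˡ w∈))) (s≤s z≤n)
  ... | right i with c ≟ i
  ...   | yes refl = DistLe-refl _ 1
  ...   | no c≢i   = Adj⇒DistLe (subst id (sym (Adj-Ext-clique c i)) c≢i) (s≤s z≤n)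

  module _ (r>0 : 0 < r) where

    original-DistLe : ∀ a w → DistLe G′ (a ↑ˡ n) (w ↑ˡ n) 1 → DistLe G a w r
    original-DistLe a w d with DistLe-1⇒≡⊎Adj d
    ... | inj₁ eq rewrite ↑ˡ-injective n a w eq = DistLe-refl w r
    ... | inj₂ aw = Adj⇒DistLe (subst id (Adj-Ext-original a w) aw) r>0

    apex-DistLe : ∀ i w → DistLe G′ (n ↑ʳ i) (w ↑ˡ n) 1 → DistLe G i w r
    apex-DistLe i w d with DistLe-1⇒≡⊎Adj d
    ... | inj₁ eq = ⊥-elim (↑ʳ≢↑ˡ n i w eq)
    ... | inj₂ iw = subst id (Adj-Ext-ball i w) iw

    restrict-WithinDist : ∀ {x X} → WithinDist G′ 1 x X →
                          ∃ λ c → WithinDist G r c (preimage (_↑ˡ n) X)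
    restrict-WithinDist {x} ball with splitAtView n n x
    ... | left a  = a , λ w w∈ → original-DistLe a w (ball _ (∈-preimage⁻ w∈))
    ... | right i = i , λ w w∈ → apex-DistLe i w (ball _ (∈-preimage⁻ w∈))

lemma7 : ∀ {n} (G : Graph n) → 0 < n → Connected G →
         (r : ℕ) → 0 < r →
         TreeBreadthLe G r ⇔ TreeBreadthLe (Ext G r) 1
lemma7 {n} G _ _ r r>0 = mk⇔ forward backward
  where
  forward : TreeBreadthLe G r → TreeBreadthLe (Ext G r) 1
  forward (D , breadth) =
    addApices (subst id (Adj-Ext-original G r _ _)) D ,
    λ t → let (c , ball) = breadth t in n ↑ʳ c , apex-WithinDist G r ball

  backward : TreeBreadthLe (Ext G r) 1 → TreeBreadthLe G r
  backward (D , breadth) =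
    comap (_↑ˡ n) (subst id (sym (Adj-Ext-original G r _ _))) D ,
    λ t → restrict-WithinDist G r r>0 (proj₂ (breadth t))
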